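{- For each set $X$ define relations on $\mathcal{P}X$ by: $x_1\sqsubseteq^{C\emptyset}x_2$ iff $x_1=\emptyset$ or $x_1=x_2$; $x_1\sqsubseteq^{C\neg\emptyset}x_2$ iff ($x_1\supseteq x_2$ and $x_2\neq\emptyset$) or $x_1=x_2$; $x_1\sqsubseteq^{C}x_2$ iff $x_1\sqsubseteq^{C\neg\emptyset}x_2$ or $x_1\sqsubseteq^{C\emptyset}x_2$. Then $\sqsubseteq^{C\emptyset}\circ\sqsubseteq^{C\neg\emptyset}\,=\,\sqsubseteq^{C\neg\emptyset}\circ\sqsubseteq^{C\emptyset}$; consequently $(\sqsubseteq^{C\emptyset}\cup\sqsubseteq^{C\neg\emptyset})^*=\sqsubseteq^{C\emptyset}\circ\sqsubseteq^{C\neg\emptyset}=\sqsubseteq^{C\neg\emptyset}\circ\sqsubseteq^{C\emptyset}$. Moreover $\sqsubseteq^{C}=\sqsubseteq^{C\emptyset}\circ\sqsubseteq^{C\neg\emptyset}$, and hence $\sqsubseteq^C$ is a preorder.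
   Context: $\mathcal{P}X$ is the set of subsets of $X$. Composition of relations: for $S,T\subseteq P\times P$, $T\circ S=\{(p,t)\mid\exists q.\,(p,q)\in S,(q,t)\in T\}$; $(\cdot)^*$ denotes reflexive-transitive closure. -}

module Defs where

open import Level using (Level; _⊔_; suc)
open import Data.Product using (_×_; ∃)
open import Data.Sum using (_⊎_)
open import Relation.Nullary using (¬_)
open import Relation.Unary using (Pred; _⊇_; _≐_; ∅)
open import Relation.Binary.Core using (Rel)

-- 𝒫X : subsets of X, as predicates at level ℓ; equality of subsets is
-- extensional equality _≐_ (mutual inclusion).
𝒫 : ∀ {a} (ℓ : Level) → Set a → Set (a ⊔ suc ℓ)
𝒫 ℓ X = Pred X ℓ

_∘ᴿ_ : ∀ {a ℓ₁ ℓ₂} {A : Set a} → Rel A ℓ₁ → Rel A ℓ₂ → Rel A _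
T ∘ᴿ S = λ p t → ∃ λ q → S p q × T q t

module _ {a ℓ : Level} {X : Set a} where

  _⊑C∅_ : Rel (𝒫 ℓ X) (a ⊔ ℓ)
  x₁ ⊑C∅ x₂ = (x₁ ≐ ∅) ⊎ (x₁ ≐ x₂)

  _⊑C¬∅_ : Rel (𝒫 ℓ X) (a ⊔ ℓ)
  x₁ ⊑C¬∅ x₂ = ((x₁ ⊇ x₂) × ¬ (x₂ ≐ ∅)) ⊎ (x₁ ≐ x₂)

  _⊑C_ : Rel (𝒫 ℓ X) (a ⊔ ℓ)
  x₁ ⊑C x₂ = (x₁ ⊑C¬∅ x₂) ⊎ (x₁ ⊑C∅ x₂)

-- ⊑C∅ and ⊑C¬∅ are preorders that commute.  For commuting preorders R and S,
-- the S-steps of any (R ∪ S)-path can be moved to the front, and consecutive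
-- steps of the same kind merge, so (R ∪ S)* = R ∘ S.  A ⊑C¬∅-step followed by
-- a ⊑C∅-step is already a single ⊑C-step: after a strict ⊑C¬∅-step the set is
-- nonempty, so the ⊑C∅-step must be trivial.  Hence ⊑C = (⊑C∅ ∪ ⊑C¬∅)*.
module Submission where

open import Defs
open import Level using (Level; _⊔_)
open import Data.Product using (_×_; _,_; proj₂)
open import Data.Sum using (inj₁; inj₂)
open import Data.Empty using (⊥-elim)
open import Relation.Unary using (_≐_)
open import Relation.Unary.Properties using (≐-refl; ≐-sym; ≐-trans)
open import Relation.Binary.Core using (Rel; _⇒_; _⇔_)
open import Relation.Binary.Definitions using (Reflexive; Transitive)
open import Relation.Binary.Structures using (IsPreorder)
open import Relation.Binary.Construct.Union using (_∪_)
open import Relation.Binary.Construct.Closure.ReflexiveTransitive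
  using (Star; ε; _◅_; _◅◅_)

module _ {a ℓ₁ ℓ₂ : Level} {A : Set a} {R : Rel A ℓ₁} {S : Rel A ℓ₂}
         (R-refl : Reflexive R) (S-refl : Reflexive S)
         (R-trans : Transitive R) (S-trans : Transitive S) where

  Star-∪⇒∘ : (S ∘ᴿ R) ⇒ (R ∘ᴿ S) → Star (R ∪ S) ⇒ (R ∘ᴿ S)
  Star-∪⇒∘ commute ε = _ , S-refl , R-refl
  Star-∪⇒∘ commute (inj₁ r ◅ rs) with Star-∪⇒∘ commute rs
  ... | _ , s , r′ with commute (_ , r , s)
  ...   | m′ , s′ , r″ = m′ , s′ , R-trans r″ r′
  Star-∪⇒∘ commute (inj₂ s ◅ rs) with Star-∪⇒∘ commute rs
  ... | m , s′ , r = m , S-trans s s′ , r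

∘⇒Star-∪ : ∀ {a ℓ₁ ℓ₂} {A : Set a} {R : Rel A ℓ₁} {S : Rel A ℓ₂} →
           (R ∘ᴿ S) ⇒ Star (R ∪ S)
∘⇒Star-∪ (_ , s , r) = inj₂ s ◅ inj₁ r ◅ ε

module _ {a ℓ : Level} {X : Set a} where

  private
    E N C : Rel (𝒫 ℓ X) (a ⊔ ℓ)
    E = _⊑C∅_
    N = _⊑C¬∅_
    C = _⊑C_

  ⊑C∅-refl : Reflexive E
  ⊑C∅-refl = inj₂ ≐-refl

  ⊑C∅-trans : Transitive E
  ⊑C∅-trans (inj₁ p≐∅) _          = inj₁ p≐∅
  ⊑C∅-trans (inj₂ p≐q) (inj₁ q≐∅) = inj₁ (≐-trans p≐q q≐∅)
  ⊑C∅-trans (inj₂ p≐q) (inj₂ q≐r) = inj₂ (≐-trans p≐q q≐r)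

  ⊑C¬∅-refl : Reflexive N
  ⊑C¬∅-refl = inj₂ ≐-refl

  ⊑C¬∅-trans : Transitive N
  ⊑C¬∅-trans (inj₁ (p⊇q , _)) (inj₁ (q⊇r , r≢∅)) =
    inj₁ ((λ x∈r → p⊇q (q⊇r x∈r)) , r≢∅)
  ⊑C¬∅-trans (inj₁ (p⊇q , q≢∅)) (inj₂ q≐r) =
    inj₁ ((λ x∈r → p⊇q (proj₂ q≐r x∈r)) , λ r≐∅ → q≢∅ (≐-trans q≐r r≐∅))
  ⊑C¬∅-trans (inj₂ p≐q) (inj₁ (q⊇r , r≢∅)) =
    inj₁ ((λ x∈r → proj₂ p≐q (q⊇r x∈r)) , r≢∅)
  ⊑C¬∅-trans (inj₂ p≐q) (inj₂ q≐r) =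
    inj₂ (≐-trans p≐q q≐r)

  ⊑C∅∘⊑C¬∅⇒⊑C¬∅∘⊑C∅ : (E ∘ᴿ N) ⇒ (N ∘ᴿ E)
  ⊑C∅∘⊑C¬∅⇒⊑C¬∅∘⊑C∅ (_ , inj₂ p≐q , e) = _ , ⊑C∅-trans (inj₂ p≐q) e , ⊑C¬∅-refl
  ⊑C∅∘⊑C¬∅⇒⊑C¬∅∘⊑C∅ (_ , inj₁ (_ , q≢∅) , inj₁ q≐∅) = ⊥-elim (q≢∅ q≐∅)
  ⊑C∅∘⊑C¬∅⇒⊑C¬∅∘⊑C∅ (_ , n , inj₂ q≐t) = _ , ⊑C∅-refl , ⊑C¬∅-trans n (inj₂ q≐t)

  ⊑C¬∅∘⊑C∅⇒⊑C∅∘⊑C¬∅ : (N ∘ᴿ E) ⇒ (E ∘ᴿ N)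
  ⊑C¬∅∘⊑C∅⇒⊑C∅∘⊑C¬∅ (_ , inj₁ p≐∅ , _) = _ , ⊑C¬∅-refl , inj₁ p≐∅
  ⊑C¬∅∘⊑C∅⇒⊑C∅∘⊑C¬∅ (_ , inj₂ p≐q , n) = _ , ⊑C¬∅-trans (inj₂ p≐q) n , ⊑C∅-refl

  ⊑C⇒⊑C∅∘⊑C¬∅ : C ⇒ (E ∘ᴿ N)
  ⊑C⇒⊑C∅∘⊑C¬∅ (inj₁ n) = _ , n , ⊑C∅-refl
  ⊑C⇒⊑C∅∘⊑C¬∅ (inj₂ e) = _ , ⊑C¬∅-refl , e

  ⊑C∅∘⊑C¬∅⇒⊑C : (E ∘ᴿ N) ⇒ C
  ⊑C∅∘⊑C¬∅⇒⊑C (_ , inj₂ p≐q , inj₁ q≐∅)        = inj₂ (inj₁ (≐-trans p≐q q≐∅))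
  ⊑C∅∘⊑C¬∅⇒⊑C (_ , inj₁ (_ , q≢∅) , inj₁ q≐∅) = ⊥-elim (q≢∅ q≐∅)
  ⊑C∅∘⊑C¬∅⇒⊑C (_ , n , inj₂ q≐t)               = inj₁ (⊑C¬∅-trans n (inj₂ q≐t))

  Star-⊑C∅∪⊑C¬∅⇒⊑C∅∘⊑C¬∅ : Star (E ∪ N) ⇒ (E ∘ᴿ N)
  Star-⊑C∅∪⊑C¬∅⇒⊑C∅∘⊑C¬∅ =
    Star-∪⇒∘ ⊑C∅-refl ⊑C¬∅-refl ⊑C∅-trans ⊑C¬∅-trans ⊑C¬∅∘⊑C∅⇒⊑C∅∘⊑C¬∅

  ⊑C-trans : Transitive C
  ⊑C-trans c c′ = ⊑C∅∘⊑C¬∅⇒⊑C (Star-⊑C∅∪⊑C¬∅⇒⊑C∅∘⊑C¬∅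
    (∘⇒Star-∪ (⊑C⇒⊑C∅∘⊑C¬∅ c) ◅◅ ∘⇒Star-∪ (⊑C⇒⊑C∅∘⊑C¬∅ c′)))

  ⊑C-isPreorder : IsPreorder _≐_ C
  ⊑C-isPreorder = record
    { isEquivalence = record { refl = ≐-refl ; sym = ≐-sym ; trans = ≐-trans }
    ; reflexive     = λ p≐q → inj₂ (inj₂ p≐q)
    ; trans         = ⊑C-trans
    }

proposition6 : {a ℓ : Level} (X : Set a) →
    ((_⊑C∅_ {a} {ℓ} {X} ∘ᴿ _⊑C¬∅_) ⇔ (_⊑C¬∅_ ∘ᴿ _⊑C∅_))
    × (Star (_⊑C∅_ {a} {ℓ} {X} ∪ _⊑C¬∅_) ⇔ (_⊑C∅_ ∘ᴿ _⊑C¬∅_))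
    × (Star (_⊑C∅_ {a} {ℓ} {X} ∪ _⊑C¬∅_) ⇔ (_⊑C¬∅_ ∘ᴿ _⊑C∅_))
    × (_⊑C_ {a} {ℓ} {X} ⇔ (_⊑C∅_ ∘ᴿ _⊑C¬∅_))
    × IsPreorder _≐_ (_⊑C_ {a} {ℓ} {X})
proposition6 X =
    (⊑C∅∘⊑C¬∅⇒⊑C¬∅∘⊑C∅ , ⊑C¬∅∘⊑C∅⇒⊑C∅∘⊑C¬∅)
  , (Star-⊑C∅∪⊑C¬∅⇒⊑C∅∘⊑C¬∅ , ∘⇒Star-∪)
  , ( (λ s → ⊑C∅∘⊑C¬∅⇒⊑C¬∅∘⊑C∅ (Star-⊑C∅∪⊑C¬∅⇒⊑C∅∘⊑C¬∅ s))
    , (λ ne → ∘⇒Star-∪ (⊑C¬∅∘⊑C∅⇒⊑C∅∘⊑C¬∅ ne)) )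
  , (⊑C⇒⊑C∅∘⊑C¬∅ , ⊑C∅∘⊑C¬∅⇒⊑C)
  , ⊑C-isPreorder
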